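{- For all positive integers $\ell$ and $\Delta$, \[ \chi'(\ell,\Delta) \le 2 \sqrt{2 \ell}\, \Delta - \sqrt{2 \ell} + 2. \] Equivalently: for any $\ell$ finite simple loopless graphs $G_1,\ldots,G_\ell$ on a common vertex set $V$, each of maximum degree at most $\Delta$, there is an edge-coloring of their union $G$ using at most $2 \sqrt{2 \ell}\, \Delta - \sqrt{2 \ell} + 2$ colors whose restriction to the edge set of each $G_i$ is a proper edge-coloring.
   Context: All graphs are finite, simple and loopless. A (proper) edge-coloring of a graph is a coloring of its edges such that any two edges sharing an endpoint receive distinct colors. The union of graphs $G_1,\ldots,G_\ell$ on the same vertex set $V$ is the simple graph $G$ on $V$ in which $uv$ is an edge iff $uv$ is an edge of at least one $G_i$. An edge-coloring of $G$ is simultaneous with respect to $G_1,\ldots,G_\ell$ if its restriction to the edge set of each $G_i$ is a proper edge-coloring of $G_i$. $\chi'(G_1,\ldots,G_\ell)$ denotes the minimum number of colors of a simultaneous edge-coloring of their union, and $\chi'(\ell,\Delta)$ denotes the largest integer $k$ such that $k=\chi'(G_1,\ldots,G_\ell)$ for some graphs $G_1,\ldots,G_\ell$ on a common vertex set, each of maximum degree at most $\Delta$. -}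

module Defs where

open import Data.Nat using (ℕ; zero; suc; _+_; _*_; _∸_; _≤_; _<_)
open import Data.Bool using (Bool; true; false; if_then_else_)
open import Data.Fin using (Fin)
open import Data.List using (List; map; allFin)
open import Data.Nat.ListAction using (sum)
open import Data.Product using (Σ; ∃; _×_; _,_)
open import Data.Sum using (_⊎_)
open import Relation.Binary.PropositionalEquality using (_≡_; _≢_)

record Graph (n : ℕ) : Set where
  field
    adj   : Fin n → Fin n → Bool
    sym   : ∀ u v → adj u v ≡ adj v u
    loopless : ∀ v → adj v v ≡ false
open Graph public

Edge : ∀ {n} → Graph n → Fin n → Fin n → Set
Edge G u v = adj G u v ≡ true

degree : ∀ {n} → Graph n → Fin n → ℕ
degree {n} G v = sum (map (λ u → if adj G v u then 1 else 0) (allFin n))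

MaxDegreeAtMost : ∀ {n} → Graph n → ℕ → Set
MaxDegreeAtMost G Δ = ∀ v → degree G v ≤ Δ

UnionEdge : ∀ {ℓ n} → (Fin ℓ → Graph n) → Fin n → Fin n → Set
UnionEdge {ℓ} Gs u v = ∃ λ (i : Fin ℓ) → Edge (Gs i) u v

record SimultaneousEdgeColoring {ℓ n} (Gs : Fin ℓ → Graph n) (k : ℕ) : Set where
  field
    color     : Fin n → Fin n → Fin k
    color-sym : ∀ u v → UnionEdge Gs u v → color u v ≡ color v u
    proper    : ∀ (i : Fin ℓ) (u v w : Fin n) → v ≢ w →
                Edge (Gs i) u v → Edge (Gs i) u w → color u v ≢ color u w

-- k ≤ 2 √(2ℓ) Δ − √(2ℓ) + 2 = 2 + √(2ℓ)(2Δ − 1), stated exactly over ℕ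
-- (for Δ ≥ 1, 2Δ − 1 ≥ 1): either k ≤ 2, or (k − 2)² ≤ 2ℓ (2Δ − 1)².
BoundSqrt : ℕ → ℕ → ℕ → Set
BoundSqrt ℓ Δ k = k ≤ 2 ⊎ ((k ∸ 2) * (k ∸ 2) ≤ 2 * ℓ * ((2 * Δ ∸ 1) * (2 * Δ ∸ 1)))

-- Colour the edges of the union greedily, in order of nonincreasing multiplicity
-- (the number of graphs G i containing the edge). When an edge ab of multiplicity m
-- is coloured, the already coloured edges it has to avoid are edges ac (or bc) of
-- multiplicity at least m lying in a common G i with ab. If there are N such c at a,
-- then N ≤ m (Δ − 1), because each of the m graphs containing ab has at most Δ − 1
-- further edges at a, and N m + m ≤ ℓ Δ, because the multiplicities of the edges at a
-- sum to at most ℓ Δ. Together N (N + 1) ≤ ℓ Δ (Δ − 1), so N ≤ s for the largest s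
-- with s (s + 1) ≤ ℓ Δ (Δ − 1); hence 2 s + 1 colours suffice, and
-- 2 s + 1 ≤ 2 + √(2ℓ) (2Δ − 1).
module Submission where

open import Data.Bool as Bool using (Bool; true; false; if_then_else_)
open import Data.Empty using (⊥-elim)
open import Data.Fin using (Fin; zero; suc)
import Data.Fin.Properties as Fin
open import Data.List using (List; []; _∷_; _++_; length; map; filter; tabulate; allFin; cartesianProduct; lookup)
open import Data.List.Membership.Propositional using (_∈_; _∉_)
open import Data.List.Membership.Propositional.Properties
  using (∈-map⁺; ∈-filter⁺; ∈-allFin; ∈-++⁺ˡ; ∈-++⁺ʳ; ∈-cartesianProduct⁺)
open import Data.List.Properties using (length-map; length-++; map-tabulate)
open import Data.List.Relation.Binary.Permutation.Propositional using (↭-sym)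
open import Data.List.Relation.Binary.Permutation.Propositional.Properties using (∈-resp-↭)
import Data.List.Relation.Unary.All as All
open import Data.List.Relation.Unary.AllPairs using (AllPairs; _∷_)
open import Data.List.Relation.Unary.Any as Any using (here; there; index; any?)
open import Data.List.Relation.Unary.Any.Properties using (lookup-index)
open import Data.List.Relation.Unary.Linked.Properties using (Linked⇒AllPairs)
import Data.List.Sort as Sort
open import Data.Nat using (ℕ; zero; suc; _+_; _*_; _∸_; _≤_; _<_; z≤n; s≤s)
open import Data.Nat.ListAction using (sum)
open import Data.Nat.Properties
open import Data.Nat.Tactic.RingSolver using (solve-∀)
open import Data.Product using (Σ; ∃; _×_; _,_; proj₁; proj₂)
open import Data.Product.Properties using (≡-dec)
open import Data.Sum using (_⊎_; inj₁; inj₂; [_,_]′)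
open import Function using (_∘_)
open import Level using (0ℓ)
open import Relation.Binary using (Rel; Symmetric; Irreflexive; DecidableEquality)
import Relation.Binary.Construct.On as On
open import Relation.Binary.PropositionalEquality
  using (_≡_; _≢_; refl; sym; trans; cong; cong₂; subst; subst₂)
open import Relation.Nullary using (¬_; yes; no; does; ¬?; _×-dec_; contradiction)
open import Relation.Nullary.Decidable using (dec-true; decidable-stable)
open import Relation.Unary using (Pred; Decidable)

open import Defs hiding (sym)

open import Algebra.Properties.Semiring.Sum +-*-semiring
  using (sum-syntax; sum-cong-≗; ∑-comm; ∑-distrib-+; *-distribˡ-sum; *-distribʳ-sum)

⟦_⟧ : Bool → ℕ
⟦ b ⟧ = if b then 1 else 0

∑-mono-≤ : ∀ {n} {f g : Fin n → ℕ} → (∀ i → f i ≤ g i) → ∑[ i < n ] f i ≤ ∑[ i < n ] g i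
∑-mono-≤ {zero}  f≤g = z≤n
∑-mono-≤ {suc n} f≤g = +-mono-≤ (f≤g zero) (∑-mono-≤ (f≤g ∘ suc))

∑-≤-* : ∀ {n c} {f : Fin n → ℕ} → (∀ i → f i ≤ c) → ∑[ i < n ] f i ≤ n * c
∑-≤-* {zero}  f≤c = z≤n
∑-≤-* {suc n} f≤c = +-mono-≤ (f≤c zero) (∑-≤-* (f≤c ∘ suc))

term≤∑ : ∀ {n} (f : Fin n → ℕ) i → f i ≤ ∑[ j < n ] f j
term≤∑ f zero    = m≤m+n _ _
term≤∑ f (suc i) = ≤-trans (term≤∑ (f ∘ suc) i) (m≤n+m _ _)

sum-tabulate : ∀ {n} (f : Fin n → ℕ) → sum (tabulate f) ≡ ∑[ i < n ] f i
sum-tabulate {zero}  f = refl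
sum-tabulate {suc n} f = cong (f zero +_) (sum-tabulate (f ∘ suc))

sum-map-allFin : ∀ {n} (f : Fin n → ℕ) → sum (map f (allFin n)) ≡ ∑[ i < n ] f i
sum-map-allFin f = trans (cong sum (map-tabulate (λ i → i) f)) (sum-tabulate f)

module _ {a p} {A : Set a} {P : Pred A p} (P? : Decidable P) where

  length-filter≡count : ∀ xs → length (filter P? xs) ≡ sum (map (λ x → ⟦ does (P? x) ⟧) xs)
  length-filter≡count []       = refl
  length-filter≡count (x ∷ xs) with does (P? x)
  ... | true  = cong suc (length-filter≡count xs)
  ... | false = length-filter≡count xs

length-filter-allFin : ∀ {n p} {P : Pred (Fin n) p} (P? : Decidable P) →
                       length (filter P? (allFin n)) ≡ ∑[ i < n ] ⟦ does (P? i) ⟧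
length-filter-allFin {n} P? = trans (length-filter≡count P? (allFin n)) (sum-map-allFin {n} _)

pronic-bound : ∀ {N m D L} → N ≤ m * D → N * m + m ≤ L → N * suc N ≤ L * D
pronic-bound {zero}              _   _ = z≤n
pronic-bound {suc N} {suc m} {D} {L} N≤mD Nm+m≤L = *-cancelˡ-≤ (suc m) (begin
  suc m * (suc N * suc (suc N))  ≡⟨ m*[n*[1+n]]≡n*[n*m+m] (suc m) (suc N) ⟩
  suc N * (suc N * suc m + suc m) ≤⟨ *-monoʳ-≤ (suc N) Nm+m≤L ⟩
  suc N * L                       ≤⟨ *-monoˡ-≤ L N≤mD ⟩
  suc m * D * L                   ≡⟨ *-assoc (suc m) D L ⟩
  suc m * (D * L)                 ≡⟨ cong (suc m *_) (*-comm D L) ⟩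
  suc m * (L * D)                 ∎)
  where
  open ≤-Reasoning
  m*[n*[1+n]]≡n*[n*m+m] : ∀ m n → m * (n * suc n) ≡ n * (n * m + m)
  m*[n*[1+n]]≡n*[n*m+m] = solve-∀

-- Applied with M i c = adj (G i) u c for a fixed vertex u: rows are the graphs,
-- columns the possible neighbours of u, and colSum c is the multiplicity of the edge uc.
module HeavyPartners {ℓ n : ℕ} (M : Fin ℓ → Fin n → Bool) where

  colSum : Fin n → ℕ
  colSum c = ∑[ i < ℓ ] ⟦ M i c ⟧

  HeavyPartner : Fin n → Fin n → Set
  HeavyPartner b c = c ≢ b × (∃ λ i → M i b ≡ true × M i c ≡ true) × colSum b ≤ colSum c

  -- Opaque so that `with heavyPartner? b c` is not undone by `does` computing through _×-dec_.
  opaque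
    heavyPartner? : ∀ b → Decidable (HeavyPartner b)
    heavyPartner? b c = ¬? (c Fin.≟ b)
                  ×-dec Fin.any? (λ i → (M i b Bool.≟ true) ×-dec (M i c Bool.≟ true))
                  ×-dec (colSum b ≤? colSum c)

  heavyPartners : Fin n → ℕ
  heavyPartners b = ∑[ c < n ] ⟦ does (heavyPartner? b c) ⟧

  module _ (b : Fin n) where

    private
      isPartner isB : Fin n → ℕ
      isPartner c = ⟦ does (heavyPartner? b c) ⟧
      isB c = ⟦ does (c Fin.≟ b) ⟧

    partner-or-b≤1 : ∀ c → isPartner c + isB c ≤ 1
    partner-or-b≤1 c with heavyPartner? b c | c Fin.≟ b
    ... | yes (c≢b , _) | yes c≡b = contradiction c≡b c≢b
    ... | yes _         | no _    = ≤-refl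
    ... | no _          | yes _   = ≤-refl
    ... | no _          | no _    = z≤n

    partners+b≤∑ : (w : Fin n → ℕ) → ∑[ c < n ] (w c * isPartner c) + w b ≤ ∑[ c < n ] w c
    partners+b≤∑ w = begin
      ∑[ c < n ] (w c * isPartner c) + w b
        ≤⟨ +-monoʳ-≤ _ (subst (_≤ ∑[ c < n ] (w c * isB c)) w[b]*1≡w[b] (term≤∑ (λ c → w c * isB c) b)) ⟩
      ∑[ c < n ] (w c * isPartner c) + ∑[ c < n ] (w c * isB c)
        ≡⟨ sym (∑-distrib-+ (λ c → w c * isPartner c) (λ c → w c * isB c)) ⟩
      ∑[ c < n ] (w c * isPartner c + w c * isB c)
        ≤⟨ ∑-mono-≤ (λ c → ≤-trans (≤-reflexive (sym (*-distribˡ-+ (w c) _ _)))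
                                   (≤-trans (*-monoʳ-≤ (w c) (partner-or-b≤1 c)) (≤-reflexive (*-identityʳ (w c))))) ⟩
      ∑[ c < n ] w c ∎
      where
      open ≤-Reasoning
      w[b]*1≡w[b] : w b * isB b ≡ w b
      w[b]*1≡w[b] rewrite dec-true (b Fin.≟ b) refl = *-identityʳ (w b)

    partner-in-common-row : ∀ c → isPartner c ≤ ∑[ i < ℓ ] (⟦ M i b ⟧ * (⟦ M i c ⟧ * isPartner c))
    partner-in-common-row c with heavyPartner? b c
    ... | no _                         = z≤n
    ... | yes (_ , (i , bᵢ , cᵢ) , _) =
      subst (_≤ ∑[ j < ℓ ] (⟦ M j b ⟧ * (⟦ M j c ⟧ * 1)))
            (cong₂ (λ x y → ⟦ x ⟧ * (⟦ y ⟧ * 1)) bᵢ cᵢ)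
            (term≤∑ (λ j → ⟦ M j b ⟧ * (⟦ M j c ⟧ * 1)) i)

    partner-weight : ∀ c → isPartner c * colSum b ≤ colSum c * isPartner c
    partner-weight c with heavyPartner? b c
    ... | no _                = z≤n
    ... | yes (_ , _ , b≤c) = subst₂ _≤_ (sym (+-identityʳ _)) (sym (*-identityʳ _)) b≤c

    module _ {Δ : ℕ} (rowSum≤Δ : ∀ i → ∑[ c < n ] ⟦ M i c ⟧ ≤ Δ) where
      open ≤-Reasoning

      partners-in-row≤ : ∀ i → ⟦ M i b ⟧ * ∑[ c < n ] (⟦ M i c ⟧ * isPartner c) ≤ ⟦ M i b ⟧ * (Δ ∸ 1)
      partners-in-row≤ i with M i b in bᵢ
      ... | false = z≤n
      ... | true  = *-monoʳ-≤ 1 (m+n≤o⇒m≤o∸n _ (≤-trans row (rowSum≤Δ i)))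
        where
        row : ∑[ c < n ] (⟦ M i c ⟧ * isPartner c) + 1 ≤ ∑[ c < n ] ⟦ M i c ⟧
        row = subst (λ x → ∑[ c < n ] (⟦ M i c ⟧ * isPartner c) + ⟦ x ⟧ ≤ ∑[ c < n ] ⟦ M i c ⟧) bᵢ (partners+b≤∑ (λ c → ⟦ M i c ⟧))

      heavyPartners≤ : heavyPartners b ≤ colSum b * (Δ ∸ 1)
      heavyPartners≤ = begin
        ∑[ c < n ] isPartner c
          ≤⟨ ∑-mono-≤ partner-in-common-row ⟩
        ∑[ c < n ] ∑[ i < ℓ ] (⟦ M i b ⟧ * (⟦ M i c ⟧ * isPartner c))
          ≡⟨ ∑-comm (λ c i → ⟦ M i b ⟧ * (⟦ M i c ⟧ * isPartner c)) ⟩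
        ∑[ i < ℓ ] ∑[ c < n ] (⟦ M i b ⟧ * (⟦ M i c ⟧ * isPartner c))
          ≡⟨ sum-cong-≗ (λ i → sym (*-distribˡ-sum ⟦ M i b ⟧ (λ c → ⟦ M i c ⟧ * isPartner c))) ⟩
        ∑[ i < ℓ ] (⟦ M i b ⟧ * ∑[ c < n ] (⟦ M i c ⟧ * isPartner c))
          ≤⟨ ∑-mono-≤ partners-in-row≤ ⟩
        ∑[ i < ℓ ] (⟦ M i b ⟧ * (Δ ∸ 1))
          ≡⟨ sym (*-distribʳ-sum (Δ ∸ 1) (λ i → ⟦ M i b ⟧)) ⟩
        colSum b * (Δ ∸ 1) ∎

      heavyPartners*colSum≤ : heavyPartners b * colSum b + colSum b ≤ ℓ * Δ
      heavyPartners*colSum≤ = begin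
        heavyPartners b * colSum b + colSum b
          ≡⟨ cong (_+ colSum b) (*-distribʳ-sum (colSum b) isPartner) ⟩
        ∑[ c < n ] (isPartner c * colSum b) + colSum b
          ≤⟨ +-monoˡ-≤ (colSum b) (∑-mono-≤ partner-weight) ⟩
        ∑[ c < n ] (colSum c * isPartner c) + colSum b
          ≤⟨ partners+b≤∑ colSum ⟩
        ∑[ c < n ] ∑[ i < ℓ ] ⟦ M i c ⟧
          ≡⟨ ∑-comm (λ c i → ⟦ M i c ⟧) ⟩
        ∑[ i < ℓ ] ∑[ c < n ] ⟦ M i c ⟧
          ≤⟨ ∑-≤-* rowSum≤Δ ⟩
        ℓ * Δ ∎

      heavyPartners-pronic : heavyPartners b * suc (heavyPartners b) ≤ ℓ * Δ * (Δ ∸ 1)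
      heavyPartners-pronic = pronic-bound heavyPartners≤ heavyPartners*colSum≤

module _ {p} {P : Pred ℕ p} (P? : Decidable P) where

  largest≤ : ℕ → ℕ
  largest≤ zero    = zero
  largest≤ (suc n) with P? (suc n)
  ... | yes _ = suc n
  ... | no _  = largest≤ n

  largest≤-satisfies : P 0 → ∀ n → P (largest≤ n)
  largest≤-satisfies p0 zero    = p0
  largest≤-satisfies p0 (suc n) with P? (suc n)
  ... | yes p[1+n] = p[1+n]
  ... | no _       = largest≤-satisfies p0 n

  largest≤-maximal : ∀ {m} n → m ≤ n → P m → m ≤ largest≤ n
  largest≤-maximal zero    m≤0   _  = m≤0
  largest≤-maximal (suc n) m≤1+n pm with P? (suc n)
  ... | yes _ = m≤1+n
  ... | no ¬p with m≤n⇒m<n∨m≡n m≤1+n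
  ...   | inj₁ (s≤s m≤n) = largest≤-maximal n m≤n pm
  ...   | inj₂ refl      = contradiction pm ¬p

pronicRoot : ℕ → ℕ
pronicRoot t = largest≤ (λ s → s * suc s ≤? t) t

pronicRoot-pronic : ∀ t → pronicRoot t * suc (pronicRoot t) ≤ t
pronicRoot-pronic t = largest≤-satisfies (λ s → s * suc s ≤? t) z≤n t

pronicRoot-maximal : ∀ {s t} → s * suc s ≤ t → s ≤ pronicRoot t
pronicRoot-maximal {s} {t} s[s+1]≤t =
  largest≤-maximal (λ s → s * suc s ≤? t) t (≤-trans (m≤m*n s (suc s)) s[s+1]≤t) s[s+1]≤t

-- (2s − 1)² ≤ 4 s (s + 1) ≤ 4 ℓ Δ (Δ − 1) ≤ 2 ℓ (2Δ − 1)²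
pronic⇒BoundSqrt : ∀ ℓ Δ s → s * suc s ≤ ℓ * Δ * (Δ ∸ 1) → BoundSqrt ℓ Δ (suc (s + s))
pronic⇒BoundSqrt ℓ Δ zero _ = inj₁ (s≤s z≤n)
pronic⇒BoundSqrt ℓ zero (suc t) le with () ← subst (suc t * suc (suc t) ≤_) (*-zeroʳ (ℓ * 0)) le
pronic⇒BoundSqrt ℓ (suc d) (suc t) le =
  inj₂ (subst (λ x → (t + suc t) * (t + suc t) ≤ 2 * ℓ * (x * x)) (sym (2*[1+d]∸1≡d+[1+d] d)) (begin
    (t + suc t) * (t + suc t)                            ≤⟨ m≤m+n _ _ ⟩
    (t + suc t) * (t + suc t) + (8 * t + 7)               ≡⟨ [2t+1]²+8t+7≡4[t+1][t+2] t ⟩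
    4 * (suc t * suc (suc t))                             ≤⟨ *-monoʳ-≤ 4 le ⟩
    4 * (ℓ * suc d * d)                                   ≤⟨ m≤m+n _ _ ⟩
    4 * (ℓ * suc d * d) + (4 * (ℓ * suc d * d) + 2 * ℓ)   ≡⟨ 8ℓd[d+1]+2ℓ≡2ℓ[2d+1]² ℓ d ⟩
    2 * ℓ * ((d + suc d) * (d + suc d))                   ∎))
  where
  open ≤-Reasoning
  2*[1+d]∸1≡d+[1+d] : ∀ d → 2 * suc d ∸ 1 ≡ d + suc d
  2*[1+d]∸1≡d+[1+d] d = cong (d +_) (+-identityʳ (suc d))
  [2t+1]²+8t+7≡4[t+1][t+2] : ∀ t → (t + suc t) * (t + suc t) + (8 * t + 7) ≡ 4 * (suc t * suc (suc t))
  [2t+1]²+8t+7≡4[t+1][t+2] = solve-∀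
  8ℓd[d+1]+2ℓ≡2ℓ[2d+1]² : ∀ ℓ d → 4 * (ℓ * suc d * d) + (4 * (ℓ * suc d * d) + 2 * ℓ) ≡ 2 * ℓ * ((d + suc d) * (d + suc d))
  8ℓd[d+1]+2ℓ≡2ℓ[2d+1]² = solve-∀

length≤⇒¬∀∈ : ∀ {k} (cs : List (Fin (suc k))) → length cs ≤ k → ¬ (∀ c → c ∈ cs)
length≤⇒¬∀∈ cs |cs|≤k ∈cs
  with i , j , i<j , same-position ← Fin.pigeonhole (s≤s |cs|≤k) (index ∘ ∈cs)
  = Fin.<-irrefl (trans (lookup-index (∈cs i)) (trans (cong (lookup cs) same-position) (sym (lookup-index (∈cs j))))) i<j

fresh-colour : ∀ {k} (cs : List (Fin (suc k))) → length cs ≤ k → ∃ λ c → c ∉ cs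
fresh-colour cs |cs|≤k with Fin.any? (λ c → ¬? (any? (c Fin.≟_) cs))
... | yes c∉cs = c∉cs
... | no ∄c∉cs = contradiction (λ c → decidable-stable (any? (c Fin.≟_) cs) (∄c∉cs ∘ (c ,_))) (length≤⇒¬∀∈ cs |cs|≤k)

module GreedyColouring {A : Set} (_≟_ : DecidableEquality A)
  (Conflict : Rel A 0ℓ) (conflict-sym : Symmetric Conflict) (conflict-irrefl : Irreflexive _≡_ Conflict)
  (weight : A → ℕ) (k : ℕ) where

  Colouring : Set
  Colouring = A → Fin (suc k)

  Proper : Colouring → List A → Set
  Proper f xs = ∀ {x y} → x ∈ xs → y ∈ xs → Conflict x y → f x ≢ f y

  FewHeavierConflicts : A → Set
  FewHeavierConflicts x = ∃ λ ys → length ys ≤ k × (∀ {y} → Conflict x y → weight x ≤ weight y → y ∈ ys)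

  _[_↦_] : Colouring → A → Fin (suc k) → Colouring
  (f [ x ↦ c ]) y with y ≟ x
  ... | yes _ = c
  ... | no _  = f y

  extend-proper : ∀ {f x c xs} → Proper f xs → (∀ {y} → y ∈ xs → Conflict x y → f y ≢ c) →
                  Proper (f [ x ↦ c ]) (x ∷ xs)
  extend-proper {x = x} f-proper c-fresh {y} {z} y∈ z∈ y~z with y ≟ x | z ≟ x
  ... | yes refl | yes refl = contradiction y~z (conflict-irrefl refl)
  ... | yes refl | no z≢x   = c-fresh (Any.tail z≢x z∈) y~z ∘ sym
  ... | no y≢x   | yes refl = c-fresh (Any.tail y≢x y∈) (conflict-sym y~z)
  ... | no y≢x   | no z≢x   = f-proper (Any.tail y≢x y∈) (Any.tail z≢x z∈) y~z

  -- The tail is coloured first, so every conflict of x that is already coloured is at least as heavy as x.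
  greedy-sorted : ∀ xs → AllPairs (λ x y → weight x ≤ weight y) xs →
                  (∀ {x} → x ∈ xs → FewHeavierConflicts x) → ∃ λ f → Proper f xs
  greedy-sorted []       _                few = (λ _ → zero) , λ ()
  greedy-sorted (x ∷ xs) (x≤xs ∷ sorted) few
    with f , f-proper ← greedy-sorted xs sorted (few ∘ there)
       | ys , |ys|≤k , ys-covers ← few (here refl)
    with c , c∉f[ys] ← fresh-colour (map f ys) (subst (_≤ k) (sym (length-map f ys)) |ys|≤k)
    = f [ x ↦ c ] , extend-proper f-proper λ y∈xs x~y f[y]≡c →
        c∉f[ys] (subst (_∈ map f ys) f[y]≡c (∈-map⁺ f (ys-covers x~y (All.lookup x≤xs y∈xs))))

  open Sort (On.decTotalOrder ≤-decTotalOrder weight) using (sort; sort-↭; sort-↗)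

  greedy : ∀ xs → (∀ {x} → x ∈ xs → FewHeavierConflicts x) → ∃ λ f → Proper f xs
  greedy xs few
    with f , f-proper ← greedy-sorted (sort xs) (Linked⇒AllPairs ≤-trans (sort-↗ xs)) (few ∘ ∈-resp-↭ (sort-↭ xs))
    = f , λ x∈xs y∈xs → f-proper (∈-sort x∈xs) (∈-sort y∈xs)
    where
    ∈-sort : ∀ {x} → x ∈ xs → x ∈ sort xs
    ∈-sort = ∈-resp-↭ (↭-sym (sort-↭ xs))

sortedPair : ∀ {n} → Fin n → Fin n → Fin n × Fin n
sortedPair u v with u Fin.≤? v
... | yes _ = u , v
... | no _  = v , u

module _ {n : ℕ} where

  sortedPair-cases : ∀ (u v : Fin n) → sortedPair u v ≡ (u , v) ⊎ sortedPair u v ≡ (v , u)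
  sortedPair-cases u v with u Fin.≤? v
  ... | yes _ = inj₁ refl
  ... | no _  = inj₂ refl

  sortedPair-comm : ∀ (u v : Fin n) → sortedPair u v ≡ sortedPair v u
  sortedPair-comm u v with u Fin.≤? v | v Fin.≤? u
  ... | yes u≤v | yes v≤u rewrite Fin.≤-antisym u≤v v≤u = refl
  ... | yes _   | no _    = refl
  ... | no _    | yes _   = refl
  ... | no u≰v  | no v≰u  = ⊥-elim ([ u≰v , v≰u ]′ (Fin.≤-total u v))

  sortedPair-injectiveʳ : ∀ {u v w : Fin n} → sortedPair u v ≡ sortedPair u w → v ≡ w
  sortedPair-injectiveʳ {u} {v} {w} eq with sortedPair-cases u v | sortedPair-cases u w
  ... | inj₁ p | inj₁ q = cong proj₂ (trans (sym p) (trans eq q))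
  ... | inj₁ p | inj₂ q = let e = trans (sym p) (trans eq q) in trans (cong proj₂ e) (cong proj₁ e)
  ... | inj₂ p | inj₁ q = let e = trans (sym p) (trans eq q) in trans (cong proj₁ e) (cong proj₂ e)
  ... | inj₂ p | inj₂ q = cong proj₁ (trans (sym p) (trans eq q))

module _ {ℓ n : ℕ} (Gs : Fin ℓ → Graph n) where

  adjacencyAt : Fin n → Fin ℓ → Fin n → Bool
  adjacencyAt u i = adj (Gs i) u

  multiplicity : Fin n → Fin n → ℕ
  multiplicity u v = ∑[ i < ℓ ] ⟦ adj (Gs i) u v ⟧

  multiplicity-comm : ∀ u v → multiplicity u v ≡ multiplicity v u
  multiplicity-comm u v = sum-cong-≗ (λ i → cong ⟦_⟧ (Graph.sym (Gs i) u v))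

  weight : Fin n × Fin n → ℕ
  weight (u , v) = multiplicity u v

  weight-sortedPair : ∀ u v → weight (sortedPair u v) ≡ multiplicity u v
  weight-sortedPair u v with sortedPair u v | sortedPair-cases u v
  ... | _ | inj₁ refl = refl
  ... | _ | inj₂ refl = multiplicity-comm v u

  data Conflict : Rel (Fin n × Fin n) 0ℓ where
    adjacent : ∀ i {u v w} → v ≢ w → Edge (Gs i) u v → Edge (Gs i) u w →
               Conflict (sortedPair u v) (sortedPair u w)

  conflict-sym : Symmetric Conflict
  conflict-sym (adjacent i v≢w uv uw) = adjacent i (v≢w ∘ sym) uw uv

  conflict-irrefl : Irreflexive _≡_ Conflict
  conflict-irrefl eq (adjacent i v≢w _ _) = v≢w (sortedPair-injectiveʳ eq)

  heavierEdgesAt : Fin n → Fin n → List (Fin n × Fin n)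
  heavierEdgesAt u v = map (sortedPair u) (filter (HeavyPartners.heavyPartner? (adjacencyAt u) v) (allFin n))

  heavierConflicts : Fin n × Fin n → List (Fin n × Fin n)
  heavierConflicts (a , b) = heavierEdgesAt a b ++ heavierEdgesAt b a

  heavierEdgesAt⊆heavierConflicts : ∀ {u v y} → y ∈ heavierEdgesAt u v → y ∈ heavierConflicts (sortedPair u v)
  heavierEdgesAt⊆heavierConflicts {u} {v} with sortedPair u v | sortedPair-cases u v
  ... | _ | inj₁ refl = ∈-++⁺ˡ
  ... | _ | inj₂ refl = ∈-++⁺ʳ (heavierEdgesAt v u)

  heavierConflicts-complete : ∀ {x y} → Conflict x y → weight x ≤ weight y → y ∈ heavierConflicts x
  heavierConflicts-complete (adjacent i {u} {v} {w} v≢w uv uw) x≤y =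
    heavierEdgesAt⊆heavierConflicts (∈-map⁺ (sortedPair u)
      (∈-filter⁺ (HeavyPartners.heavyPartner? (adjacencyAt u) v) (∈-allFin w)
        (v≢w ∘ sym , (i , uv , uw) , subst₂ _≤_ (weight-sortedPair u v) (weight-sortedPair u w) x≤y)))

  module _ {Δ : ℕ} (degree≤Δ : ∀ i → MaxDegreeAtMost (Gs i) Δ) where

    maxHeavierEdges : ℕ
    maxHeavierEdges = pronicRoot (ℓ * Δ * (Δ ∸ 1))

    length-heavierEdgesAt : ∀ u v → length (heavierEdgesAt u v) ≤ maxHeavierEdges
    length-heavierEdgesAt u v = begin
      length (heavierEdgesAt u v)
        ≡⟨ length-map (sortedPair u) (filter (heavyPartner? v) (allFin n)) ⟩
      length (filter (heavyPartner? v) (allFin n))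
        ≡⟨ length-filter-allFin (heavyPartner? v) ⟩
      heavyPartners v
        ≤⟨ pronicRoot-maximal (heavyPartners-pronic v rowSum≤Δ) ⟩
      maxHeavierEdges ∎
      where
      open ≤-Reasoning
      open HeavyPartners (adjacencyAt u)
      rowSum≤Δ : ∀ i → ∑[ c < n ] ⟦ adj (Gs i) u c ⟧ ≤ Δ
      rowSum≤Δ i = subst (_≤ Δ) (sum-map-allFin {n} _) (degree≤Δ i u)

    open GreedyColouring (≡-dec Fin._≟_ Fin._≟_) Conflict conflict-sym conflict-irrefl weight
                         (maxHeavierEdges + maxHeavierEdges)

    fewHeavierConflicts : ∀ x → FewHeavierConflicts x
    fewHeavierConflicts (a , b) =
      heavierConflicts (a , b) ,
      subst (_≤ _) (sym (length-++ (heavierEdgesAt a b)))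
            (+-mono-≤ (length-heavierEdgesAt a b) (length-heavierEdgesAt b a)) ,
      heavierConflicts-complete

    simultaneousColouring : SimultaneousEdgeColoring Gs (suc (maxHeavierEdges + maxHeavierEdges))
    simultaneousColouring
      with f , f-proper ← greedy (cartesianProduct (allFin n) (allFin n)) (λ {x} _ → fewHeavierConflicts x)
      = record
        { color     = λ u v → f (sortedPair u v)
        ; color-sym = λ u v _ → cong f (sortedPair-comm u v)
        ; proper    = λ i u v w v≢w uv uw → f-proper ∈-pairs ∈-pairs (adjacent i v≢w uv uw)
        }
      where
      ∈-pairs : ∀ {x} → x ∈ cartesianProduct (allFin n) (allFin n)
      ∈-pairs = ∈-cartesianProduct⁺ (∈-allFin _) (∈-allFin _)

theorem1 : (ℓ Δ : ℕ) → 0 < ℓ → 0 < Δ →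
    (n : ℕ) (Gs : Fin ℓ → Graph n) → (∀ i → MaxDegreeAtMost (Gs i) Δ) →
    Σ ℕ (λ k → BoundSqrt ℓ Δ k × SimultaneousEdgeColoring Gs k)
theorem1 ℓ Δ _ _ n Gs degree≤Δ =
  suc (s + s) , pronic⇒BoundSqrt ℓ Δ s (pronicRoot-pronic (ℓ * Δ * (Δ ∸ 1))) , simultaneousColouring Gs degree≤Δ
  where
  s = maxHeavierEdges Gs degree≤Δ
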